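{- Let $\mathcal{P}$ be a profile of unrooted phylogenetic trees whose display graph $G(\mathcal{P})$ is connected, let $\mathcal{F}$ be a minimal complete set of pairwise parallel legal minimal cuts of $G(\mathcal{P})$, and let $D_F$ ($F\in\mathcal{F}$) and $G'$ be constructed as in the context. Let $F\in\mathcal{F}$ with $D_F=(X,Y)$, $F_\cup=X\cup Y$, and let $H$ be the subgraph of $G'$ induced by $F_\cup$. Then (1) $H$ is chordal, and (2) $H$ contains no illegal clique.
   Context: A phylogenetic tree is an unrooted tree whose leaves are bijectively labeled; a profile $\mathcal{P}$ is a finite collection of phylogenetic trees. The display graph $G(\mathcal{P})$ is the union of the trees of $\mathcal{P}$, where leaves with the same label are identified and all other vertices of different trees are distinct; leaf vertices are the labels, all others internal; an edge is internal if both endpoints are internal, otherwise non-internal. A minimal cut of a connected graph is an inclusion-minimal disconnecting edge set (leaving exactly two components); minimal cuts $F,F'$ of $G$ are parallel if $G-F$ has at most one component $H$ with $E(H)\cap F'\neq\emptyset$. A cut $F$ of $G(\mathcal{P})$ is legal if (LC1) for every $T\in\mathcal{P}$ the edges of $T$ in $F$ are incident on a common vertex and (LC2) every component of $G(\mathcal{P})-F$ contains an edge. A set $\mathcal{F}$ of pairwise parallel legal minimal cuts is complete if for every input tree $T$ and every internal edge $e$ of $T$ some $F\in\mathcal{F}$ has $e$ as its only edge of $T$; minimal complete if no proper subset is complete. Construction of $D_F$: fix an arbitrary order on $\mathcal{F}$, $W=\emptyset$. For each successive $F$: let $F'$ be the internal edges $e\in F$ that are the only edge of their tree in $F$; $A,B$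 the components of $G(\mathcal{P})-F$; $X=V(A)\cap V(F')$, $Y=V(B)\cap V(F')$. For every edge $e\in F'$ whose endpoints lie in different sets of $D_I$ for some $I\in W$, let $Q$ be the unique component of $G(\mathcal{P})-I$ with $E(Q)\cap F\neq\emptyset$, $v$ the endpoint of $e$ in $Q$, and replace the endpoints of $e$ in $X$ and $Y$ by $v$. For every non-internal edge $f\in F$ that is the only edge of its tree in $F$, add the internal endpoint of $f$ to both $X$ and $Y$. For every tree with more than one edge in $F$, add the common endpoint of those edges to both $X$ and $Y$. Set $D_F=(X,Y)$, add $F$ to $W$. For $D_F=(X,Y)$ write $X=\{x_1,\dots,x_m,z_1,\dots,z_p\}$, $Y=\{y_1,\dots,y_m,z_1,\dots,z_p\}$ with $m>0$, $p\ge0$, each $\{x_i,y_i\}$ an internal edge; $O_F$ is the family of sets $\{x_1,\dots,x_j,y_j,\dots,y_m,z_1,\dots,z_p\}$, $j\in\{1,\dots,m\}$. $G'$ is obtained from $G(\mathcal{P})$ by making, for every $F\in\mathcal{F}$, each of $X$, $Y$ and each set of $O_F$ a clique, and making $N_{G(\mathcal{P})}(\ell)$ a clique for every leaf $\ell$. Edges of $G'$ not in $G(\mathcal{P})$ are fill-in edges. A clique of $G'$ is illegal if it contains a fill-in edge with a leaf vertex as an endpoint, or contains an internal edge of $G(\mathcal{P})$ together with another edge of $G(\mathcal{P})$. -}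

module Defs where

open import Data.Nat using (ℕ; zero; suc; _<_; _≤_)
open import Data.Fin using (Fin; toℕ)
open import Data.Product using (Σ; ∃; ∃-syntax; _×_; _,_; proj₁; proj₂)
open import Data.Sum using (_⊎_; inj₁; inj₂)
open import Data.Unit using (⊤)
open import Level using (0ℓ)
open import Relation.Nullary using (¬_)
open import Relation.Unary using (Pred; _⊆_; _≐_)
open import Relation.Binary.PropositionalEquality using (_≡_; _≢_)

module _ {V E : Set} (ends : E → V × V) where

  Links : E → V → V → Set
  Links e u w = (proj₁ (ends e) ≡ u × proj₂ (ends e) ≡ w)
              ⊎ (proj₁ (ends e) ≡ w × proj₂ (ends e) ≡ u)

  Endpoint : V → E → Set
  Endpoint v e = proj₁ (ends e) ≡ v ⊎ proj₂ (ends e) ≡ v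

  data Conn (P : E → Set) (u : V) : V → Set where
    here : Conn P u u
    step : ∀ {x w} (e : E) → P e → Conn P u x → Links e x w → Conn P u w

-- Vertices of a tree with n internal vertices: Fin n ⊎ Fin L
-- (inj₁ = internal vertex, inj₂ ℓ = the leaf labelled ℓ; so the leaves
-- are labelled bijectively by construction).

TV : ℕ → ℕ → Set
TV L n = Fin n ⊎ Fin L

-- vertex set of a tree: all internal vertices, and the labels that occur
InT : ∀ {L n m} → (Fin m → TV L n × TV L n) → TV L n → Set
InT ends (inj₁ 0ℓ) = ⊤
InT ends (inj₂ ℓ) = ∃[ e ] Endpoint ends (inj₂ ℓ) e

record Tree (L : ℕ) : Set where
  field
    n    : ℕ
    m    : ℕ
    ends : Fin m → TV L n × TV L n
    connected : ∀ u w → InT ends u → InT ends w → Conn ends (λ _ → ⊤) u w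
    -- ... and acyclic (every edge is a bridge; this also excludes loops)
    acyclic   : ∀ e → ¬ Conn ends (λ e' → e' ≢ e)
                                  (proj₁ (ends e)) (proj₂ (ends e))
    -- the labelled vertices are exactly the leaves (degree-1 vertices):
    leafDeg1  : ∀ ℓ e e' → Endpoint ends (inj₂ ℓ) e
                         → Endpoint ends (inj₂ ℓ) e' → e ≡ e'
    intDeg2   : ∀ x → ∃[ e ] ∃[ e' ] (e ≢ e' × Endpoint ends (inj₁ x) e
                                              × Endpoint ends (inj₁ x) e')

-- A profile: k trees over labels Fin L, every label occurring in some tree
-- (so Fin L is exactly the set of leaf vertices of the display graph).
record Profile : Set where
  field
    L k   : ℕ
    T     : Fin k → Tree L
    cover : ∀ (ℓ : Fin L) → ∃[ i ] ∃[ e ]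
              Endpoint (Tree.ends (T i)) (inj₂ ℓ) e

module _ (P : Profile) where
  open Profile P

  -- vertices: internal vertices of the trees (kept distinct) ⊎ labels
  DV : Set
  DV = (Σ (Fin k) λ i → Fin (Tree.n (T i))) ⊎ Fin L

  DE : Set
  DE = Σ (Fin k) λ i → Fin (Tree.m (T i))

  tree : DE → Fin k
  tree = proj₁

  private
    emb : (i : Fin k) → TV L (Tree.n (T i)) → DV
    emb i (inj₁ x) = inj₁ (i , x)
    emb i (inj₂ ℓ) = inj₂ ℓ

  dends : DE → DV × DV
  dends (i , j) = emb i (proj₁ (Tree.ends (T i) j))
                , emb i (proj₂ (Tree.ends (T i) j))

  IsInternal : DV → Set
  IsInternal v = ∃[ x ] v ≡ inj₁ x

  IsLeaf : DV → Set
  IsLeaf v = ∃[ ℓ ] v ≡ inj₂ ℓ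

  InternalEdge : DE → Set
  InternalEdge e = IsInternal (proj₁ (dends e)) × IsInternal (proj₂ (dends e))

  Connected : Set
  Connected = ∀ u w → Conn dends (λ _ → ⊤) u w

  ConnMinus : Pred DE 0ℓ → DV → DV → Set
  ConnMinus F = Conn dends (λ e → ¬ F e)

  Disconnecting : Pred DE 0ℓ → Set
  Disconnecting F = ∃[ u ] ∃[ w ] ¬ ConnMinus F u w

  MinimalCut : Pred DE 0ℓ → Set₁
  MinimalCut F = Disconnecting F × (∀ F' → F' ⊆ F → Disconnecting F' → F ⊆ F')

  -- F, F' parallel: at most one component of G - F contains an edge of F'
  Parallel : Pred DE 0ℓ → Pred DE 0ℓ → Set
  Parallel F F' = ∀ e e' → F' e → F' e' → ¬ F e → ¬ F e'
                  → ConnMinus F (proj₁ (dends e)) (proj₁ (dends e'))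

  -- (LC1) the edges of each tree in F are incident on a common vertex,
  -- (LC2) every component of G - F contains an edge.
  Legal : Pred DE 0ℓ → Set
  Legal F = (∀ i → ∃[ v ] ∀ e → F e → tree e ≡ i → Endpoint dends v e)
          × (∀ v → ∃[ e ] (¬ F e × ConnMinus F v (proj₁ (dends e))))

  OnlyOfTree : Pred DE 0ℓ → DE → Set
  OnlyOfTree F e = F e × (∀ e' → F e' → tree e' ≡ tree e → e' ≡ e)

  CompleteOn : ∀ {c} → (Fin c → Pred DE 0ℓ) → Pred (Fin c) 0ℓ → Set
  CompleteOn 𝓕 S = ∀ e → InternalEdge e → ∃[ a ] (S a × OnlyOfTree (𝓕 a) e)

  -- 𝓕 = {𝓕 a | a : Fin c} (listed without repetition; the enumeration
  -- also fixes the arbitrary order used in the construction of D_F) is a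
  -- minimal complete set of pairwise parallel legal minimal cuts.
  MinCompleteFamily : ∀ c → (Fin c → Pred DE 0ℓ) → Set₁
  MinCompleteFamily c 𝓕 =
      (∀ a b → 𝓕 a ≐ 𝓕 b → a ≡ b)
    × (∀ a → MinimalCut (𝓕 a))
    × (∀ a → Legal (𝓕 a))
    × (∀ a b → Parallel (𝓕 a) (𝓕 b))
    × CompleteOn 𝓕 (λ _ → ⊤)
    × (∀ S → CompleteOn 𝓕 S → ∀ a → S a)

  -- The construction of D_F = (DX a , DY a) for F = 𝓕 a.

  module Construction {c : ℕ} (𝓕 : Fin c → Pred DE 0ℓ)
                      (DX DY : Fin c → Pred DV 0ℓ) where

    F′ : Fin c → DE → Set
    F′ a e = OnlyOfTree (𝓕 a) e × InternalEdge e

    CrossesAt : Fin c → DE → Set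
    CrossesAt b e =
        (DX b (proj₁ (dends e)) × DY b (proj₂ (dends e)))
      ⊎ (DY b (proj₁ (dends e)) × DX b (proj₂ (dends e)))

    Earlier : Fin c → Fin c → Set
    Earlier b a = toℕ b < toℕ a

    Crosses : Fin c → DE → Set
    Crosses a e = ∃[ b ] (Earlier b a × CrossesAt b e)

    InQ : Fin c → Fin c → DV → Set
    InQ b a v = ∃[ e ] (𝓕 a e × ¬ 𝓕 b e × ConnMinus (𝓕 b) v (proj₁ (dends e)))

    TwoEdgesOf : Fin c → Fin k → Set
    TwoEdgesOf a i = ∃[ e ] ∃[ e' ] (e ≢ e' × 𝓕 a e × 𝓕 a e'
                                     × tree e ≡ i × tree e' ≡ i)

    -- the vertices added to both X and Y (non-internal single edges and
    -- common endpoints of trees with several edges in F)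
    Shared : Fin c → DV → Set
    Shared a v =
        (∃[ f ] (OnlyOfTree (𝓕 a) f × ¬ InternalEdge f
                 × Endpoint dends v f × IsInternal v))
      ⊎ (∃[ i ] (TwoEdgesOf a i
                 × ∀ e → 𝓕 a e → tree e ≡ i → Endpoint dends v e))

    -- one admissible outcome of the step for 𝓕 a: the component A is
    -- the one of the vertex pA, B the other one; sel and rep record the
    -- choice of I ∈ W and the resulting replacement vertex v.
    StepSpec : Fin c → Set
    StepSpec a = Σ DV λ pA → Σ (DE → Fin c) λ sel → Σ (DE → DV) λ rep →
      ( (∀ e → F′ a e → Crosses a e →
            Earlier (sel e) a × CrossesAt (sel e) e
          × Endpoint dends (rep e) e × InQ (sel e) a (rep e))
      × DX a ≐ (λ v →
            (∃[ e ] (F′ a e × ¬ Crosses a e × Endpoint dends v e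
                     × ConnMinus (𝓕 a) pA v))
          ⊎ (∃[ e ] (F′ a e × Crosses a e × rep e ≡ v))
          ⊎ Shared a v)
      × DY a ≐ (λ v →
            (∃[ e ] (F′ a e × ¬ Crosses a e × Endpoint dends v e
                     × ¬ ConnMinus (𝓕 a) pA v))
          ⊎ (∃[ e ] (F′ a e × Crosses a e × rep e ≡ v))
          ⊎ Shared a v) )

  DSpec : ∀ {c} → (Fin c → Pred DE 0ℓ) → (DX DY : Fin c → Pred DV 0ℓ) → Set
  DSpec 𝓕 DX DY = ∀ a → Construction.StepSpec 𝓕 DX DY a

  record Decomp (X Y : Pred DV 0ℓ) : Set where
    field
      m p  : ℕ
      m>0  : 0 < m
      x y  : Fin m → DV
      z    : Fin p → DV
      x-inj : ∀ i j → x i ≡ x j → i ≡ j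
      y-inj : ∀ i j → y i ≡ y j → i ≡ j
      z-inj : ∀ i j → z i ≡ z j → i ≡ j
      xz    : ∀ i j → x i ≢ z j
      yz    : ∀ i j → y i ≢ z j
      X≐    : X ≐ (λ v → (∃[ i ] x i ≡ v) ⊎ (∃[ j ] z j ≡ v))
      Y≐    : Y ≐ (λ v → (∃[ i ] y i ≡ v) ⊎ (∃[ j ] z j ≡ v))
      xy-edge : ∀ i → ∃[ e ] (Links dends e (x i) (y i) × InternalEdge e)
    O : Fin m → Pred DV 0ℓ
    O j v = (∃[ i ] (toℕ i ≤ toℕ j × x i ≡ v))
          ⊎ (∃[ i ] (toℕ j ≤ toℕ i × y i ≡ v))
          ⊎ (∃[ l ] z l ≡ v)

  module GPrime {c : ℕ} (DX DY : Fin c → Pred DV 0ℓ)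
                (dec : ∀ a → Decomp (DX a) (DY a)) where

    GAdj : DV → DV → Set
    GAdj u w = ∃[ e ] Links dends e u w

    Nbh : Fin L → Pred DV 0ℓ
    Nbh ℓ u = GAdj u (inj₂ ℓ)

    Both : Pred DV 0ℓ → DV → DV → Set
    Both S u w = S u × S w

    Adj′ : DV → DV → Set
    Adj′ u w = u ≢ w ×
      ( GAdj u w
      ⊎ (∃[ a ] (Both (DX a) u w ⊎ Both (DY a) u w
                 ⊎ ∃[ j ] Both (Decomp.O (dec a) j) u w))
      ⊎ (∃[ ℓ ] Both (Nbh ℓ) u w) )

    FillIn : DV → DV → Set
    FillIn u w = Adj′ u w × ¬ GAdj u w

    Fᵤ : Fin c → Pred DV 0ℓ
    Fᵤ a v = DX a v ⊎ DY a v

    CliqueH : Fin c → Pred DV 0ℓ → Set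
    CliqueH a K = K ⊆ Fᵤ a × (∀ u w → K u → K w → u ≢ w → Adj′ u w)

    EdgeIn : Pred DV 0ℓ → DE → Set
    EdgeIn K e = K (proj₁ (dends e)) × K (proj₂ (dends e))

    Illegal : Pred DV 0ℓ → Set
    Illegal K =
        (∃[ u ] ∃[ w ] (K u × K w × FillIn u w × (IsLeaf u ⊎ IsLeaf w)))
      ⊎ (∃[ e ] ∃[ e' ] (e ≢ e' × EdgeIn K e × EdgeIn K e' × InternalEdge e))

    CycSucc : ∀ {n} → Fin n → Fin n → Set
    CycSucc {n} i j = toℕ j ≡ suc (toℕ i) ⊎ (suc (toℕ i) ≡ n × toℕ j ≡ 0)

    ChordalH : Fin c → Set
    ChordalH a = ∀ n → 4 ≤ n → (cy : Fin n → DV)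
      → (∀ i j → cy i ≡ cy j → i ≡ j)
      → (∀ i → Fᵤ a (cy i))
      → (∀ i j → CycSucc i j → Adj′ (cy i) (cy j))
      → ∃[ i ] ∃[ j ] (i ≢ j × ¬ CycSucc i j × ¬ CycSucc j i
                       × Adj′ (cy i) (cy j))

    NoIllegalH : Fin c → Set₁
    NoIllegalH a = ∀ K → CliqueH a K → ¬ Illegal K

module Submission where

-- Every vertex of D_a = (X , Y) enters through an edge of F_a, and an internal edge with both
-- ends in X ∪ Y is the only F_a-edge of its tree and is split by F_a.  Hence the internal
-- edges of H are the rungs x_i y_i, with x_i in the component A of G − F_a and y_i outside.
-- If x_p and y_q are adjacent in G′ then p ≤ q: a set of O_a gives p ≤ j ≤ q, while a clique
-- created by another cut F_b, or a common leaf neighbour, would join A to its complement in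
-- G − F_a (for F_b through the parallelism of F_a and F_b).  So the cliques X and Y cover H
-- and their cross edges are ordered like intervals: H has no chordless cycle, and no clique
-- contains two rungs.  Classical steps are taken inside ¬¬, which suffices because every
-- conclusion is negative or decidable.

open import Defs
open import Data.Nat using (ℕ; zero; suc; _+_; _≤_; _≤?_; s≤s)
open import Data.Nat.Properties using (≤-refl; ≤-trans; ≤-reflexive; <-irrefl; <-≤-trans; ≰⇒>; <⇒≤; ≤-antisym; <-cmp)
open import Data.Fin using (Fin; toℕ; #_; _≟_)
open import Data.Fin.Properties using (toℕ-injective)
open import Data.Product using (∃-syntax; _×_; _,_; proj₁; proj₂; map₂; swap)
open import Data.Product.Properties using (≡-dec)
open import Data.Sum using (_⊎_; inj₁; inj₂; [_,_]′)
import Data.Sum as ⊎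
open import Data.Empty using (⊥; ⊥-elim)
open import Effect.Monad using (RawMonad)
open import Function using (_∘_)
open import Level using (0ℓ)
open import Relation.Binary using (tri<; tri≈; tri>)
open import Relation.Binary.PropositionalEquality using (_≡_; _≢_; refl; sym; trans; cong; subst)
open import Relation.Nullary using (¬_; Dec; yes; no; contradiction)
open import Relation.Nullary.Decidable using (decidable-stable; ¬¬-excluded-middle)
open import Relation.Nullary.Negation using (DoubleNegation; ¬¬-Monad; ¬¬-map)
open import Relation.Unary using (Pred)

open RawMonad (¬¬-Monad {0ℓ}) using (pure; _>>=_)

module Walks {V E : Set} (ends : E → V × V) where

  Links-sym : ∀ {e u w} → Links ends e u w → Links ends e w u
  Links-sym (inj₁ (p , q)) = inj₂ (p , q)
  Links-sym (inj₂ (p , q)) = inj₁ (p , q)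

  Links⇒Endpointˡ : ∀ {e u w} → Links ends e u w → Endpoint ends u e
  Links⇒Endpointˡ (inj₁ (p , _)) = inj₁ p
  Links⇒Endpointˡ (inj₂ (_ , q)) = inj₂ q

  Links⇒Endpointʳ : ∀ {e u w} → Links ends e u w → Endpoint ends w e
  Links⇒Endpointʳ (inj₁ (_ , q)) = inj₂ q
  Links⇒Endpointʳ (inj₂ (p , _)) = inj₁ p

  Endpoints⇒Links : ∀ {e v w} → Endpoint ends v e → Endpoint ends w e → v ≢ w
                  → Links ends e v w
  Endpoints⇒Links (inj₁ p) (inj₁ q) v≢w = ⊥-elim (v≢w (trans (sym p) q))
  Endpoints⇒Links (inj₁ p) (inj₂ q) _   = inj₁ (p , q)
  Endpoints⇒Links (inj₂ p) (inj₁ q) _   = inj₂ (q , p)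
  Endpoints⇒Links (inj₂ p) (inj₂ q) v≢w = ⊥-elim (v≢w (trans (sym p) q))

  Links⇒loop : ∀ {e v} → Links ends e v v → proj₁ (ends e) ≡ proj₂ (ends e)
  Links⇒loop (inj₁ (p , q)) = trans p (sym q)
  Links⇒loop (inj₂ (p , q)) = trans p (sym q)

  Endpoint-unique : ∀ {e v w w'} → Endpoint ends v e → Endpoint ends w e
                  → Endpoint ends w' e → v ≢ w → v ≢ w' → w ≡ w'
  Endpoint-unique (inj₁ p) (inj₁ q) _        v≢w _    = ⊥-elim (v≢w (trans (sym p) q))
  Endpoint-unique (inj₁ p) (inj₂ q) (inj₁ r) _   v≢w' = ⊥-elim (v≢w' (trans (sym p) r))
  Endpoint-unique (inj₁ _) (inj₂ q) (inj₂ r) _   _    = trans (sym q) r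
  Endpoint-unique (inj₂ _) (inj₁ q) (inj₁ r) _   _    = trans (sym q) r
  Endpoint-unique (inj₂ p) (inj₁ q) (inj₂ r) _   v≢w' = ⊥-elim (v≢w' (trans (sym p) r))
  Endpoint-unique (inj₂ p) (inj₂ q) _        v≢w _    = ⊥-elim (v≢w (trans (sym p) q))

  Endpoint-in : ∀ {e v} {S : V → Set} → Endpoint ends v e
              → S (proj₁ (ends e)) → S (proj₂ (ends e)) → S v
  Endpoint-in (inj₁ refl) s₁ _ = s₁
  Endpoint-in (inj₂ refl) _ s₂ = s₂

  Conn-trans : ∀ {Q u v w} → Conn ends Q u v → Conn ends Q v w → Conn ends Q u w
  Conn-trans c here             = c
  Conn-trans c (step e q c' l) = step e q (Conn-trans c c') l

  Conn-sym : ∀ {Q u w} → Conn ends Q u w → Conn ends Q w u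
  Conn-sym here           = here
  Conn-sym (step e q c l) = Conn-trans (step e q here (Links-sym l)) (Conn-sym c)

  Conn-edge : ∀ {Q e u w} → Q e → Links ends e u w → Conn ends Q u w
  Conn-edge {e = e} q l = step e q here l

  Conn-to-proj₁ : ∀ {Q v e} → Q e → Endpoint ends v e → Conn ends Q v (proj₁ (ends e))
  Conn-to-proj₁ q (inj₁ refl) = here
  Conn-to-proj₁ q (inj₂ p)    = Conn-edge q (inj₂ (refl , p))

module TwoCliqueCycles {V : Set} (_~_ : V → V → Set) (X Y : Pred V 0ℓ)
  (X-clique : ∀ {u w} → X u → X w → u ≢ w → u ~ w)
  (Y-clique : ∀ {u w} → Y u → Y w → u ≢ w → u ~ w)
  (no-crossing : ∀ {u u' w w'} → X u → X u' → Y w → Y w' → u ≢ w → u' ≢ w'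
               → u' ~ w → w' ~ u → u ~ w ⊎ u' ~ w')
  where

  -- definitionally GPrime.CycSucc, so has-chord proves GPrime.ChordalH
  Succ : ∀ {n} → Fin n → Fin n → Set
  Succ {n} i j = toℕ j ≡ suc (toℕ i) ⊎ (suc (toℕ i) ≡ n × toℕ j ≡ 0)

  Chord : ∀ {n} → (Fin n → V) → Set
  Chord cy = ∃[ i ] ∃[ j ] (i ≢ j × ¬ Succ i j × ¬ Succ j i × cy i ~ cy j)

  private
    infix 4 _↛_
    _↛_ : ∀ {n} → Fin n → Fin n → Set
    i ↛ j = ¬ Succ i j

    module Cycle {n} (cy : Fin n → V) (cy-injective : ∀ i j → cy i ≡ cy j → i ≡ j) where

      chord : ∀ i j → i ≢ j → i ↛ j → j ↛ i → cy i ~ cy j → Chord cy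
      chord i j i≢j i↛j j↛i i~j = i , j , i≢j , i↛j , j↛i , i~j

      cy≢ : ∀ {i j} → i ≢ j → cy i ≢ cy j
      cy≢ i≢j e = i≢j (cy-injective _ _ e)

      X-chord : ∀ i j → i ≢ j → i ↛ j → j ↛ i → X (cy i) → X (cy j) → Chord cy
      X-chord i j i≢j i↛j j↛i xi xj = chord i j i≢j i↛j j↛i (X-clique xi xj (cy≢ i≢j))

      Y-chord : ∀ i j → i ≢ j → i ↛ j → j ↛ i → Y (cy i) → Y (cy j) → Chord cy
      Y-chord i j i≢j i↛j j↛i yi yj = chord i j i≢j i↛j j↛i (Y-clique yi yj (cy≢ i≢j))

    module Indices (m : ℕ) where
      i₀ i₁ i₂ i₃ : Fin (4 + m)
      i₀ = # 0
      i₁ = # 1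
      i₂ = # 2
      i₃ = # 3

      0↛2 : i₀ ↛ i₂
      0↛2 (inj₁ ())
      0↛2 (inj₂ (() , _))
      2↛0 : i₂ ↛ i₀
      2↛0 (inj₁ ())
      2↛0 (inj₂ (() , _))
      1↛3 : i₁ ↛ i₃
      1↛3 (inj₁ ())
      1↛3 (inj₂ (() , _))
      3↛1 : i₃ ↛ i₁
      3↛1 (inj₁ ())
      3↛1 (inj₂ (_ , ()))

    module Indices₅ (m : ℕ) where
      open Indices (suc m) public
      i₄ : Fin (5 + m)
      i₄ = # 4

      0↛3 : i₀ ↛ i₃
      0↛3 (inj₁ ())
      0↛3 (inj₂ (() , _))
      3↛0 : i₃ ↛ i₀
      3↛0 (inj₁ ())
      3↛0 (inj₂ (() , _))
      1↛4 : i₁ ↛ i₄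
      1↛4 (inj₁ ())
      1↛4 (inj₂ (() , _))
      4↛1 : i₄ ↛ i₁
      4↛1 (inj₁ ())
      4↛1 (inj₂ (_ , ()))
      2↛4 : i₂ ↛ i₄
      2↛4 (inj₁ ())
      2↛4 (inj₂ (() , _))
      4↛2 : i₄ ↛ i₂
      4↛2 (inj₁ ())
      4↛2 (inj₂ (_ , ()))

    module Sides {m} (cy : Fin (4 + m) → V) (cy-inj : ∀ i j → cy i ≡ cy j → i ≡ j) where
      open Indices m
      open Cycle cy cy-inj

      InX InY : Fin (4 + m) → Set
      InX i = X (cy i)
      InY i = Y (cy i)

      by-sides : (InX i₀ → InX i₁ → InY i₂ → InY i₃ → Chord cy)
               → (InX i₀ → InY i₁ → InY i₂ → InX i₃ → Chord cy)
               → (InY i₀ → InX i₁ → InX i₂ → InY i₃ → Chord cy)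
               → (InY i₀ → InY i₁ → InX i₂ → InX i₃ → Chord cy)
               → (∀ i → InX i ⊎ InY i) → Chord cy
      by-sides xxyy xyyx yxxy yyxx side with side i₀ | side i₁ | side i₂ | side i₃
      ... | inj₁ x₀ | _       | inj₁ x₂ | _       = X-chord i₀ i₂ (λ ()) 0↛2 2↛0 x₀ x₂
      ... | inj₂ y₀ | _       | inj₂ y₂ | _       = Y-chord i₀ i₂ (λ ()) 0↛2 2↛0 y₀ y₂
      ... | _       | inj₁ x₁ | _       | inj₁ x₃ = X-chord i₁ i₃ (λ ()) 1↛3 3↛1 x₁ x₃
      ... | _       | inj₂ y₁ | _       | inj₂ y₃ = Y-chord i₁ i₃ (λ ()) 1↛3 3↛1 y₁ y₃
      ... | inj₁ x₀ | inj₁ x₁ | inj₂ y₂ | inj₂ y₃ = xxyy x₀ x₁ y₂ y₃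
      ... | inj₁ x₀ | inj₂ y₁ | inj₂ y₂ | inj₁ x₃ = xyyx x₀ y₁ y₂ x₃
      ... | inj₂ y₀ | inj₁ x₁ | inj₁ x₂ | inj₂ y₃ = yxxy y₀ x₁ x₂ y₃
      ... | inj₂ y₀ | inj₂ y₁ | inj₁ x₂ | inj₁ x₃ = yyxx y₀ y₁ x₂ x₃

  -- Opposite vertices on a common side give a chord; otherwise the sides alternate in
  -- pairs, and no-crossing (length 4) or the side of a fifth vertex gives one.
  has-chord : ∀ n → 4 ≤ n → (cy : Fin n → V) → (∀ i j → cy i ≡ cy j → i ≡ j)
            → (∀ i → X (cy i) ⊎ Y (cy i)) → (∀ i j → Succ i j → cy i ~ cy j)
            → Chord cy
  has-chord 1 (s≤s ())
  has-chord 2 (s≤s (s≤s ()))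
  has-chord 3 (s≤s (s≤s (s≤s ())))
  has-chord (suc (suc (suc (suc zero)))) _ cy cy-inj side adj = by-sides
    (λ x₀ x₁ y₂ y₃ → [ chord i₀ i₂ (λ ()) 0↛2 2↛0 , chord i₁ i₃ (λ ()) 1↛3 3↛1 ]′
                       (no-crossing x₀ x₁ y₂ y₃ (cy≢ (λ ())) (cy≢ (λ ())) 1~2 3~0))
    (λ x₀ y₁ y₂ x₃ → [ chord i₃ i₁ (λ ()) 3↛1 1↛3 , chord i₀ i₂ (λ ()) 0↛2 2↛0 ]′
                       (no-crossing x₃ x₀ y₁ y₂ (cy≢ (λ ())) (cy≢ (λ ())) 0~1 2~3))
    (λ y₀ x₁ x₂ y₃ → [ chord i₁ i₃ (λ ()) 1↛3 3↛1 , chord i₂ i₀ (λ ()) 2↛0 0↛2 ]′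
                       (no-crossing x₁ x₂ y₃ y₀ (cy≢ (λ ())) (cy≢ (λ ())) 2~3 0~1))
    (λ y₀ y₁ x₂ x₃ → [ chord i₂ i₀ (λ ()) 2↛0 0↛2 , chord i₃ i₁ (λ ()) 3↛1 1↛3 ]′
                       (no-crossing x₂ x₃ y₀ y₁ (cy≢ (λ ())) (cy≢ (λ ())) 3~0 1~2))
    side
    where
    open Indices 0
    open Cycle cy cy-inj
    open Sides cy cy-inj
    0~1 : cy i₀ ~ cy i₁
    0~1 = adj i₀ i₁ (inj₁ refl)
    1~2 : cy i₁ ~ cy i₂
    1~2 = adj i₁ i₂ (inj₁ refl)
    2~3 : cy i₂ ~ cy i₃
    2~3 = adj i₂ i₃ (inj₁ refl)
    3~0 : cy i₃ ~ cy i₀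
    3~0 = adj i₃ i₀ (inj₂ (refl , refl))
  has-chord (suc (suc (suc (suc (suc m))))) _ cy cy-inj side adj = by-sides
    (λ _ x₁ y₂ _ → [ (λ x₄ → X-chord i₁ i₄ (λ ()) 1↛4 4↛1 x₁ x₄)
                   , (λ y₄ → Y-chord i₂ i₄ (λ ()) 2↛4 4↛2 y₂ y₄) ]′ (side i₄))
    (λ x₀ _ _ x₃ → X-chord i₀ i₃ (λ ()) 0↛3 3↛0 x₀ x₃)
    (λ y₀ _ _ y₃ → Y-chord i₀ i₃ (λ ()) 0↛3 3↛0 y₀ y₃)
    (λ _ y₁ x₂ _ → [ (λ x₄ → X-chord i₂ i₄ (λ ()) 2↛4 4↛2 x₂ x₄)
                   , (λ y₄ → Y-chord i₁ i₄ (λ ()) 1↛4 4↛1 y₁ y₄) ]′ (side i₄))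
    side
    where
    open Indices₅ m
    open Cycle cy cy-inj
    open Sides cy cy-inj

module DisplayGraph (P : Profile) where
  open Profile P
  open Walks (dends P) public

  V : Set
  V = DV P

  E : Set
  E = DE P

  end₁ end₂ : E → V
  end₁ e = proj₁ (dends P e)
  end₂ e = proj₂ (dends P e)

  _≟ᴱ_ : (e e' : E) → Dec (e ≡ e')
  _≟ᴱ_ = ≡-dec _≟_ _≟_

  private
    embed : (i : Fin k) → TV L (Tree.n (T i)) → V
    embed i (inj₁ x) = inj₁ (i , x)
    embed i (inj₂ ℓ) = inj₂ ℓ

    embed-injective : ∀ i {s t} → embed i s ≡ embed i t → s ≡ t
    embed-injective i {inj₁ _} {inj₁ _} refl = refl
    embed-injective i {inj₂ _} {inj₂ _} refl = refl
    embed-injective i {inj₁ _} {inj₂ _} ()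
    embed-injective i {inj₂ _} {inj₁ _} ()

    embed-tree : ∀ j s {i x} → embed j s ≡ inj₁ (i , x) → j ≡ i
    embed-tree j (inj₁ _) refl = refl

    embed-leaf : ∀ j s {ℓ} → embed j s ≡ inj₂ ℓ → s ≡ inj₂ ℓ
    embed-leaf j (inj₂ _) refl = refl

    src tgt : ∀ i → Fin (Tree.m (T i)) → TV L (Tree.n (T i))
    src i m = proj₁ (Tree.ends (T i) m)
    tgt i m = proj₂ (Tree.ends (T i) m)

    embed-ends : ∀ i → Fin (Tree.m (T i)) → V × V
    embed-ends i m = embed i (src i m) , embed i (tgt i m)

    dends-tree : ∀ i m → dends P (i , m) ≡ embed-ends i m
    dends-tree i m with Tree.ends (T i) m
    ... | inj₁ _ , inj₁ _ = refl
    ... | inj₁ _ , inj₂ _ = refl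
    ... | inj₂ _ , inj₁ _ = refl
    ... | inj₂ _ , inj₂ _ = refl

    Endpoint-tree : ∀ {i m v} → Endpoint (dends P) v (i , m) → Endpoint (embed-ends i) v m
    Endpoint-tree {i} {m} {v} = subst (λ d → proj₁ d ≡ v ⊎ proj₂ d ≡ v) (dends-tree i m)

    Links-tree : ∀ {i m v w} → Links (dends P) (i , m) v w → Links (embed-ends i) m v w
    Links-tree {i} {m} {v} {w} =
      subst (λ d → (proj₁ d ≡ v × proj₂ d ≡ w) ⊎ (proj₁ d ≡ w × proj₂ d ≡ v)) (dends-tree i m)

    Links-tree-parallel : ∀ {i m m' v w} → Links (embed-ends i) m v w → Links (embed-ends i) m' v w
                        → Links (Tree.ends (T i)) m' (src i m) (tgt i m)
    Links-tree-parallel {i} (inj₁ (a , b)) (inj₁ (c , d)) =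
      inj₁ (embed-injective i (trans c (sym a)) , embed-injective i (trans d (sym b)))
    Links-tree-parallel {i} (inj₁ (a , b)) (inj₂ (c , d)) =
      inj₂ (embed-injective i (trans c (sym b)) , embed-injective i (trans d (sym a)))
    Links-tree-parallel {i} (inj₂ (a , b)) (inj₁ (c , d)) =
      inj₂ (embed-injective i (trans c (sym b)) , embed-injective i (trans d (sym a)))
    Links-tree-parallel {i} (inj₂ (a , b)) (inj₂ (c , d)) =
      inj₁ (embed-injective i (trans c (sym a)) , embed-injective i (trans d (sym b)))

  endpoint-tree : ∀ {i x} e → Endpoint (dends P) (inj₁ (i , x)) e → tree P e ≡ i
  endpoint-tree (j , m) p with Endpoint-tree p
  ... | inj₁ q = embed-tree j _ q
  ... | inj₂ q = embed-tree j _ q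

  no-loop : ∀ e → end₁ e ≢ end₂ e
  no-loop (i , m) eq = Tree.acyclic (T i) m (subst (Conn _ _ (src i m)) src≡tgt here)
    where
    src≡tgt : src i m ≡ tgt i m
    src≡tgt = embed-injective i (subst (λ d → proj₁ d ≡ proj₂ d) (dends-tree i m) eq)

  Links⇒≢ : ∀ {e v w} → Links (dends P) e v w → v ≢ w
  Links⇒≢ {e} l refl = no-loop e (Links⇒loop l)

  -- A second edge of T i between the ends of m would survive the deletion of m.
  Links-unique : ∀ e e' {v w} → tree P e ≡ tree P e'
               → Links (dends P) e v w → Links (dends P) e' v w → e ≡ e'
  Links-unique (i , m) (.i , m') refl l l' with m' ≟ m
  ... | yes refl = refl
  ... | no m'≢m  = ⊥-elim (Tree.acyclic (T i) m
                      (step m' m'≢m here (Links-tree-parallel (Links-tree l) (Links-tree l'))))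

  leaf-edge-unique : ∀ {ℓ} e e' → tree P e ≡ tree P e'
                   → Endpoint (dends P) (inj₂ ℓ) e → Endpoint (dends P) (inj₂ ℓ) e' → e ≡ e'
  leaf-edge-unique (i , m) (.i , m') refl p p' =
    cong (i ,_) (Tree.leafDeg1 (T i) _ m m' (in-tree m p) (in-tree m' p'))
    where
    in-tree : ∀ n → Endpoint (dends P) (inj₂ _) (i , n) → Endpoint (Tree.ends (T i)) (inj₂ _) n
    in-tree n q with Endpoint-tree q
    ... | inj₁ r = inj₁ (embed-leaf i _ r)
    ... | inj₂ r = inj₂ (embed-leaf i _ r)

  InternalEdge⇒IsInternal : ∀ {e v} → InternalEdge P e → Endpoint (dends P) v e → IsInternal P v
  InternalEdge⇒IsInternal ((x , p) , _) (inj₁ refl) = x , p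
  InternalEdge⇒IsInternal (_ , (x , p)) (inj₂ refl) = x , p

  IsInternal⇒InternalEdge : ∀ {e v w} → Links (dends P) e v w → IsInternal P v → IsInternal P w
                          → InternalEdge P e
  IsInternal⇒InternalEdge (inj₁ (refl , refl)) iv iw = iv , iw
  IsInternal⇒InternalEdge (inj₂ (refl , refl)) iv iw = iw , iv

  IsInternal-tree : ∀ {v e e'} → IsInternal P v → Endpoint (dends P) v e → Endpoint (dends P) v e'
                  → tree P e ≡ tree P e'
  IsInternal-tree (_ , refl) p p' = trans (endpoint-tree _ p) (sym (endpoint-tree _ p'))

  leaf-not-internal : ∀ {ℓ} → ¬ IsInternal P (inj₂ ℓ)
  leaf-not-internal (_ , ())

-- By minimality G − (F ∖ {e}) is connected, and a walk there uses e only to pass between its ends.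
module MinimalCutEdge (P : Profile) {F : Pred (DE P) 0ℓ} (F-min : MinimalCut P F)
                      {e : DE P} (Fe : F e) where
  open DisplayGraph P

  private
    F∖e : Pred E 0ℓ
    F∖e g = F g × g ≢ e

    Sep : V → V → Set
    Sep = ConnMinus P F

    -- u reaches w in G − F, possibly passing once through the edge e
    ViaE : V → V → Set
    ViaE u w = Sep u w ⊎ ((Sep u (end₁ e) ⊎ Sep u (end₂ e)) × (Sep (end₁ e) w ⊎ Sep (end₂ e) w))

    ViaE-through-e : ∀ {u x w} → ViaE u x → Links (dends P) e x w → ViaE u w
    ViaE-through-e (inj₂ (u~e , _)) l = inj₂ (u~e , to-w l)
      where
      to-w : ∀ {x w} → Links (dends P) e x w → Sep (end₁ e) w ⊎ Sep (end₂ e) w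
      to-w (inj₁ (_ , refl)) = inj₂ here
      to-w (inj₂ (refl , _)) = inj₁ here
    ViaE-through-e (inj₁ c) (inj₁ (refl , refl)) = inj₂ (inj₁ c , inj₂ here)
    ViaE-through-e (inj₁ c) (inj₂ (refl , refl)) = inj₂ (inj₂ c , inj₁ here)

    ViaE-extend : ∀ {u x w g} → ¬ F g → ViaE u x → Links (dends P) g x w → ViaE u w
    ViaE-extend ¬Fg (inj₁ c)            l = inj₁ (step _ ¬Fg c l)
    ViaE-extend ¬Fg (inj₂ (a , inj₁ c)) l = inj₂ (a , inj₁ (step _ ¬Fg c l))
    ViaE-extend ¬Fg (inj₂ (a , inj₂ c)) l = inj₂ (a , inj₂ (step _ ¬Fg c l))

    walk⇒ViaE : ∀ {u w} → ConnMinus P F∖e u w → DoubleNegation (ViaE u w)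
    walk⇒ViaE here = pure (inj₁ here)
    walk⇒ViaE (step g ¬F∖e c l) = do
      r ← walk⇒ViaE c
      yes Fg ← ¬¬-excluded-middle
        where no ¬Fg → pure (ViaE-extend ¬Fg r l)
      yes refl ← pure (g ≟ᴱ e)
        where no g≢e → contradiction (Fg , g≢e) ¬F∖e
      pure (ViaE-through-e r l)

    ViaE⇒Sep : Sep (end₁ e) (end₂ e) → ∀ {u w} → ViaE u w → Sep u w
    ViaE⇒Sep _ (inj₁ c)                  = c
    ViaE⇒Sep _ (inj₂ (inj₁ a , inj₁ b)) = Conn-trans a b
    ViaE⇒Sep s (inj₂ (inj₁ a , inj₂ b)) = Conn-trans a (Conn-trans s b)
    ViaE⇒Sep s (inj₂ (inj₂ a , inj₁ b)) = Conn-trans a (Conn-trans (Conn-sym s) b)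
    ViaE⇒Sep _ (inj₂ (inj₂ a , inj₂ b)) = Conn-trans a b

    F∖e-connects : ¬ Disconnecting P F∖e
    F∖e-connects d = proj₂ (proj₂ F-min F∖e proj₁ d Fe) refl

  ends-separated : ¬ Sep (end₁ e) (end₂ e)
  ends-separated s with proj₁ F-min
  ... | u , w , ¬u~w = F∖e-connects (u , w , λ c → walk⇒ViaE c (¬u~w ∘ ViaE⇒Sep s))

  reaches-an-end : ∀ v → DoubleNegation (Sep (end₁ e) v ⊎ Sep (end₂ e) v)
  reaches-an-end v ¬reach = F∖e-connects (end₁ e , v , λ c → walk⇒ViaE c (¬reach ∘ from-end₁))
    where
    from-end₁ : ViaE (end₁ e) v → Sep (end₁ e) v ⊎ Sep (end₂ e) v
    from-end₁ (inj₁ c)       = inj₁ c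
    from-end₁ (inj₂ (_ , r)) = r

module CutSides (P : Profile) {c : ℕ} (𝓕 : Fin c → Pred (DE P) 0ℓ)
                (𝓕-minimal : ∀ a → MinimalCut P (𝓕 a))
                (𝓕-parallel : ∀ a b → Parallel P (𝓕 a) (𝓕 b))
                (DX DY : Fin c → Pred (DV P) 0ℓ) (D-spec : DSpec P 𝓕 DX DY) where
  open DisplayGraph P
  open Construction P 𝓕 DX DY public

  Sep : Fin c → V → V → Set
  Sep a = ConnMinus P (𝓕 a)

  anchor : Fin c → V
  anchor a = proj₁ (D-spec a)

  sel : Fin c → E → Fin c
  sel a = proj₁ (proj₂ (D-spec a))

  rep : Fin c → E → V
  rep a = proj₁ (proj₂ (proj₂ (D-spec a)))

  rep-spec : ∀ a e → F′ a e → Crosses a e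
           → Earlier (sel a e) a × CrossesAt (sel a e) e
           × Endpoint (dends P) (rep a e) e × InQ (sel a e) a (rep a e)
  rep-spec a = proj₁ (proj₂ (proj₂ (proj₂ (D-spec a))))

  rep-endpoint : ∀ {a e} → F′ a e → Crosses a e → Endpoint (dends P) (rep a e) e
  rep-endpoint {a} {e} f cr = proj₁ (proj₂ (proj₂ (rep-spec a e f cr)))

  Plain : Fin c → V → Set
  Plain a v = ∃[ e ] (F′ a e × ¬ Crosses a e × Endpoint (dends P) v e)

  Replaced : Fin c → V → Set
  Replaced a v = ∃[ e ] (F′ a e × Crosses a e × rep a e ≡ v)

  data Origin (a : Fin c) (v : V) : Set where
    plain    : Plain a v → Origin a v
    replaced : Replaced a v → Origin a v
    shared   : Shared a v → Origin a v

  X-cases : ∀ {a v} → DX a v → (Plain a v × Sep a (anchor a) v) ⊎ Replaced a v ⊎ Shared a v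
  X-cases {a} x with proj₁ (proj₁ (proj₂ (proj₂ (proj₂ (proj₂ (D-spec a)))))) x
  ... | inj₁ (e , f , nc , ve , s) = inj₁ ((e , f , nc , ve) , s)
  ... | inj₂ r                     = inj₂ r

  Y-cases : ∀ {a v} → DY a v → (Plain a v × ¬ Sep a (anchor a) v) ⊎ Replaced a v ⊎ Shared a v
  Y-cases {a} y with proj₁ (proj₂ (proj₂ (proj₂ (proj₂ (proj₂ (D-spec a)))))) y
  ... | inj₁ (e , f , nc , ve , ¬s) = inj₁ ((e , f , nc , ve) , ¬s)
  ... | inj₂ r                      = inj₂ r

  plain-in-X : ∀ {a v} → Plain a v → Sep a (anchor a) v → DX a v
  plain-in-X {a} (e , f , nc , ve) s =
    proj₂ (proj₁ (proj₂ (proj₂ (proj₂ (proj₂ (D-spec a)))))) (inj₁ (e , f , nc , ve , s))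

  plain-in-Y : ∀ {a v} → Plain a v → ¬ Sep a (anchor a) v → DY a v
  plain-in-Y {a} (e , f , nc , ve) ¬s =
    proj₂ (proj₂ (proj₂ (proj₂ (proj₂ (proj₂ (D-spec a)))))) (inj₁ (e , f , nc , ve , ¬s))

  cases⇒Origin : ∀ {a v} {S : Set} → (Plain a v × S) ⊎ Replaced a v ⊎ Shared a v → Origin a v
  cases⇒Origin (inj₁ (p , _))  = plain p
  cases⇒Origin (inj₂ (inj₁ r)) = replaced r
  cases⇒Origin (inj₂ (inj₂ s)) = shared s

  DX⇒Origin : ∀ {a v} → DX a v → Origin a v
  DX⇒Origin = cases⇒Origin ∘ X-cases

  DY⇒Origin : ∀ {a v} → DY a v → Origin a v
  DY⇒Origin = cases⇒Origin ∘ Y-cases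

  DX⊎DY⇒Origin : ∀ {a v} → DX a v ⊎ DY a v → Origin a v
  DX⊎DY⇒Origin = [ DX⇒Origin , DY⇒Origin ]′

  only-of-tree : ∀ {a g e} → OnlyOfTree P (𝓕 a) g → 𝓕 a e → tree P e ≡ tree P g → e ≡ g
  only-of-tree o Fe t = proj₂ o _ Fe t

  only-F-edge-at : ∀ {a g e v} → OnlyOfTree P (𝓕 a) g → 𝓕 a e → IsInternal P v
                 → Endpoint (dends P) v g → Endpoint (dends P) v e → e ≡ g
  only-F-edge-at o Fe iv vg ve = only-of-tree o Fe (IsInternal-tree iv ve vg)

  only-excludes-two : ∀ {a g} → OnlyOfTree P (𝓕 a) g → ¬ TwoEdgesOf a (tree P g)
  only-excludes-two o (e₁ , e₂ , e₁≢e₂ , F₁ , F₂ , t₁ , t₂) =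
    e₁≢e₂ (trans (only-of-tree o F₁ t₁) (sym (only-of-tree o F₂ t₂)))

  private
    data Support (a : Fin c) (v : V) : Set where
      single  : ∀ {g} → OnlyOfTree P (𝓕 a) g → Endpoint (dends P) v g → Support a v
      several : ∀ {i} → TwoEdgesOf a i
              → (∀ e → 𝓕 a e → tree P e ≡ i → Endpoint (dends P) v e) → Support a v

    support : ∀ {a v} → Origin a v → Support a v
    support (plain (_ , f , _ , ep))        = single (proj₁ f) ep
    support (replaced (_ , f , cr , refl))  = single (proj₁ f) (rep-endpoint f cr)
    support (shared (inj₁ (_ , o , _ , ep , _))) = single o ep
    support (shared (inj₂ (_ , two , all))) = several two all

    several-tree : ∀ {a i v h} → TwoEdgesOf a i
                 → (∀ e → 𝓕 a e → tree P e ≡ i → Endpoint (dends P) v e)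
                 → IsInternal P v → Endpoint (dends P) v h → tree P h ≡ i
    several-tree (e₁ , _ , _ , F₁ , _ , t₁ , _) all iv vh =
      trans (IsInternal-tree iv vh (all e₁ F₁ t₁)) t₁

  internal-edge-in-F′ : ∀ {a e v w} → InternalEdge P e → Links (dends P) e v w
                      → Origin a v → Origin a w → F′ a e
  internal-edge-in-F′ {a} {e} {v} {w} int l o o' = by-support (support o) (support o')
    where
    iv : IsInternal P v
    iv = InternalEdge⇒IsInternal int (Links⇒Endpointˡ l)
    iw : IsInternal P w
    iw = InternalEdge⇒IsInternal int (Links⇒Endpointʳ l)

    single-several : ∀ {g i u} → OnlyOfTree P (𝓕 a) g → tree P g ≡ tree P e
                   → TwoEdgesOf a i → (∀ e' → 𝓕 a e' → tree P e' ≡ i → Endpoint (dends P) u e')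
                   → IsInternal P u → Endpoint (dends P) u e → ⊥
    single-several {g} o tg two all iu ue =
      only-excludes-two o (subst (TwoEdgesOf a) (trans (sym (several-tree two all iu ue)) (sym tg)) two)

    by-support : Support a v → Support a w → F′ a e
    by-support (single {g} og vg) (single {g'} og' wg') = subst (F′ a) g≡e (og , int′)
      where
      tg : tree P g ≡ tree P e
      tg = IsInternal-tree iv vg (Links⇒Endpointˡ l)
      g'≡g : g' ≡ g
      g'≡g = only-of-tree og (proj₁ og')
               (trans (IsInternal-tree iw wg' (Links⇒Endpointʳ l)) (sym tg))
      g≡e : g ≡ e
      g≡e = Links-unique g e tg
              (Endpoints⇒Links vg (subst (Endpoint (dends P) w) g'≡g wg') (Links⇒≢ l)) l
      int′ : InternalEdge P g
      int′ = subst (InternalEdge P) (sym g≡e) int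
    by-support (single og vg) (several two all) =
      ⊥-elim (single-several og (IsInternal-tree iv vg (Links⇒Endpointˡ l)) two all iw (Links⇒Endpointʳ l))
    by-support (several two all) (single og wg) =
      ⊥-elim (single-several og (IsInternal-tree iw wg (Links⇒Endpointʳ l)) two all iv (Links⇒Endpointˡ l))
    by-support (several {i} (e₁ , e₂ , e₁≢e₂ , F₁ , F₂ , t₁ , t₂) all) (several {i'} two' all') =
      ⊥-elim (e₁≢e₂ (Links-unique e₁ e₂ (trans t₁ (sym t₂)) (links e₁ F₁ t₁) (links e₂ F₂ t₂)))
      where
      i'≡i : i' ≡ i
      i'≡i = trans (sym (several-tree two' all' iw (Links⇒Endpointʳ l)))
                   (several-tree (e₁ , e₂ , e₁≢e₂ , F₁ , F₂ , t₁ , t₂) all iv (Links⇒Endpointˡ l))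
      links : ∀ g → 𝓕 a g → tree P g ≡ i → Links (dends P) g v w
      links g Fg tg = Endpoints⇒Links (all g Fg tg) (all' g Fg (trans tg (sym i'≡i))) (Links⇒≢ l)

  module _ {a g v} (f : F′ a g) (vg : Endpoint (dends P) v g) where
    private
      iv : IsInternal P v
      iv = InternalEdge⇒IsInternal (proj₂ f) vg

    replaced-along : Replaced a v → Crosses a g × rep a g ≡ v
    replaced-along (e , f' , cr , refl)
      with only-F-edge-at (proj₁ f) (proj₁ (proj₁ f')) iv vg (rep-endpoint f' cr)
    ... | refl = cr , refl

    not-shared-along : ¬ Shared a v
    not-shared-along (inj₁ (h , o , ¬int , vh , _))
      with only-F-edge-at (proj₁ f) (proj₁ o) iv vg vh
    ... | refl = ¬int (proj₂ f)
    not-shared-along (inj₂ (i , two , all)) =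
      only-excludes-two (proj₁ f) (subst (TwoEdgesOf a) (sym (several-tree two all iv vg)) two)

    origin-along : Origin a v → ¬ Crosses a g ⊎ (Crosses a g × rep a g ≡ v)
    origin-along (plain (e , f' , nc , ve))
      with only-F-edge-at (proj₁ f) (proj₁ (proj₁ f')) iv vg ve
    ... | refl = inj₁ nc
    origin-along (replaced r) = inj₂ (replaced-along r)
    origin-along (shared s)   = ⊥-elim (not-shared-along s)

  edge-with-origins : ∀ {a e v w} → InternalEdge P e → Links (dends P) e v w
                    → Origin a v → Origin a w → F′ a e × ¬ Crosses a e
  edge-with-origins {a} {e} {v} {w} int l o o' =
    f , uncrossed (origin-along f (Links⇒Endpointˡ l) o) (origin-along f (Links⇒Endpointʳ l) o')
    where
    f : F′ a e
    f = internal-edge-in-F′ int l o o'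
    -- two replacements for e would be the same vertex
    uncrossed : ¬ Crosses a e ⊎ (Crosses a e × rep a e ≡ v)
              → ¬ Crosses a e ⊎ (Crosses a e × rep a e ≡ w) → ¬ Crosses a e
    uncrossed (inj₁ nc) _                       = nc
    uncrossed (inj₂ _)  (inj₁ nc)               = nc
    uncrossed (inj₂ (_ , r≡v)) (inj₂ (_ , r≡w)) = λ _ → Links⇒≢ l (trans (sym r≡v) r≡w)

  CrossesAt⇒Origins : ∀ {a e} → CrossesAt a e → Origin a (end₁ e) × Origin a (end₂ e)
  CrossesAt⇒Origins (inj₁ (x , y)) = DX⇒Origin x , DY⇒Origin y
  CrossesAt⇒Origins (inj₂ (y , x)) = DY⇒Origin y , DX⇒Origin x

  crossing-not-recrossed : ∀ {a b e} → InternalEdge P e → CrossesAt b e → Earlier a b → ¬ CrossesAt a e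
  crossing-not-recrossed int cr a<b cr' =
    proj₂ (edge-with-origins int (inj₁ (refl , refl)) (proj₁ origins) (proj₂ origins)) (_ , a<b , cr')
    where
    origins : Origin _ (end₁ _) × Origin _ (end₂ _)
    origins = CrossesAt⇒Origins cr

  ends-split : ∀ {a e} → F′ a e → ¬ Crosses a e → DoubleNegation (CrossesAt a e)
  ends-split {a} {e} f nc = do
    s₁ ← ¬¬-excluded-middle
    s₂ ← ¬¬-excluded-middle
    sides s₁ s₂
    where
    open MinimalCutEdge P (𝓕-minimal a) (proj₁ (proj₁ f))
    p₁ : Plain a (end₁ e)
    p₁ = e , f , nc , inj₁ refl
    p₂ : Plain a (end₂ e)
    p₂ = e , f , nc , inj₂ refl
    sides : Dec (Sep a (anchor a) (end₁ e)) → Dec (Sep a (anchor a) (end₂ e))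
          → DoubleNegation (CrossesAt a e)
    sides (yes s₁) (yes s₂) = contradiction (Conn-trans (Conn-sym s₁) s₂) ends-separated
    sides (yes s₁) (no ¬s₂) = pure (inj₁ (plain-in-X p₁ s₁ , plain-in-Y p₂ ¬s₂))
    sides (no ¬s₁) (yes s₂) = pure (inj₂ (plain-in-Y p₁ ¬s₁ , plain-in-X p₂ s₂))
    sides (no ¬s₁) (no ¬s₂) _ = reaches-an-end (anchor a) [ ¬s₁ ∘ Conn-sym , ¬s₂ ∘ Conn-sym ]′

  uncrossed-in-one-cut : ∀ {a b e} → a ≢ b → F′ a e → ¬ Crosses a e → F′ b e → ¬ Crosses b e → ⊥
  uncrossed-in-one-cut {a} {b} a≢b fa nca fb ncb with <-cmp (toℕ a) (toℕ b)
  ... | tri< a<b _ _ = ends-split fa nca (λ ca → ncb (a , a<b , ca))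
  ... | tri≈ _ a≡b _ = a≢b (toℕ-injective a≡b)
  ... | tri> _ _ b<a = ends-split fb ncb (λ cb → nca (b , b<a , cb))

  in-Q : ∀ {a b v} → a ≢ b → Plain a v → Origin b v → DoubleNegation (InQ a b v)
  in-Q {a} {b} {v} a≢b (e , fa , nca , ve) = by-origin
    where
    iv : IsInternal P v
    iv = InternalEdge⇒IsInternal (proj₂ fa) ve

    -- an F_b-edge at v either avoids F_a, and then lies in Q, or it is e
    at : ∀ {g} → 𝓕 b g → Endpoint (dends P) v g
       → (g ≡ e → DoubleNegation (InQ a b v)) → DoubleNegation (InQ a b v)
    at {g} Fb vg k = do
      yes Fa ← ¬¬-excluded-middle
        where no ¬Fa → pure (g , Fb , ¬Fa , Conn-to-proj₁ ¬Fa vg)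
      k (only-F-edge-at (proj₁ fa) Fa iv ve vg)

    via-sel : ∀ I → CrossesAt I e → InQ I b v → DoubleNegation (InQ a b v)
    via-sel I crI inQ with <-cmp (toℕ I) (toℕ a)
    ... | tri< I<a _ _ = contradiction (I , I<a , crI) nca
    ... | tri≈ _ I≡a _ = pure (subst (λ J → InQ J b v) (toℕ-injective I≡a) inQ)
    ... | tri> _ _ a<I = λ _ → ends-split fa nca (crossing-not-recrossed (proj₂ fa) crI a<I)

    by-origin : Origin b v → DoubleNegation (InQ a b v)
    by-origin (plain (g , fb , ncb , vg)) = at (proj₁ (proj₁ fb)) vg λ g≡e →
      contradiction (subst (F′ b) g≡e fb , subst (λ h → ¬ Crosses b h) g≡e ncb)
                    (λ (fb' , ncb') → uncrossed-in-one-cut a≢b fa nca fb' ncb')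
    by-origin (replaced (g , fb , cr , refl)) with rep-spec b g fb cr
    ... | _ , crI , rg , inQ = at (proj₁ (proj₁ fb)) rg λ { refl → via-sel _ crI inQ }
    by-origin (shared (inj₁ (h , o , ¬int , vh , _))) = at (proj₁ o) vh λ h≡e →
      contradiction (subst (InternalEdge P) (sym h≡e) (proj₂ fa)) ¬int
    by-origin (shared (inj₂ (_ , (e₁ , e₂ , e₁≢e₂ , F₁ , F₂ , t₁ , t₂) , all))) =
      at F₁ (all e₁ F₁ t₁) λ e₁≡e → at F₂ (all e₂ F₂ t₂) λ e₂≡e →
      contradiction (trans e₁≡e (sym e₂≡e)) e₁≢e₂

  -- Parallelism of F_a and F_b joins the two components Q.
  plain-ends-joined : ∀ {a b u w} → a ≢ b → Plain a u → Plain a w → Origin b u → Origin b w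
                    → DoubleNegation (Sep a u w)
  plain-ends-joined {a} {b} a≢b pu pw ou ow = do
    g , Fg , ¬Fag , u~g ← in-Q a≢b pu ou
    h , Fh , ¬Fah , w~h ← in-Q a≢b pw ow
    pure (Conn-trans u~g (Conn-trans (𝓕-parallel a b g h Fg Fh ¬Fag ¬Fah) (Conn-sym w~h)))

  Origin⇒IsInternal : ∀ {a v} → Origin a v → IsInternal P v
  Origin⇒IsInternal (plain (_ , f , _ , ve)) = InternalEdge⇒IsInternal (proj₂ f) ve
  Origin⇒IsInternal (replaced (_ , f , cr , refl)) =
    InternalEdge⇒IsInternal (proj₂ f) (rep-endpoint f cr)
  Origin⇒IsInternal (shared (inj₁ (_ , _ , _ , _ , iv))) = iv
  Origin⇒IsInternal {v = inj₁ x} (shared (inj₂ _)) = x , refl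
  Origin⇒IsInternal {v = inj₂ _}
    (shared (inj₂ (_ , (e₁ , e₂ , e₁≢e₂ , F₁ , F₂ , t₁ , t₂) , all))) =
      ⊥-elim (e₁≢e₂ (leaf-edge-unique e₁ e₂ (trans t₁ (sym t₂)) (all e₁ F₁ t₁) (all e₂ F₂ t₂)))

  plain-excludes : ∀ {a v} → Plain a v → ¬ (Replaced a v ⊎ Shared a v)
  plain-excludes (_ , f , nc , ve) = [ nc ∘ proj₁ ∘ replaced-along f ve , not-shared-along f ve ]′

  plain-X-side : ∀ {a v} → Plain a v → DX a v → Sep a (anchor a) v
  plain-X-side p x with X-cases x
  ... | inj₁ (_ , s) = s
  ... | inj₂ r       = contradiction r (plain-excludes p)

  plain-Y-side : ∀ {a v} → Plain a v → DY a v → ¬ Sep a (anchor a) v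
  plain-Y-side p y with Y-cases y
  ... | inj₁ (_ , ¬s) = ¬s
  ... | inj₂ r        = contradiction r (plain-excludes p)

  plain-not-in-X∩Y : ∀ {a v} → Plain a v → DX a v → ¬ DY a v
  plain-not-in-X∩Y p x y = plain-Y-side p y (plain-X-side p x)

  plain-edge-avoids-leaf : ∀ {a v g ℓ} → Plain a v → Links (dends P) g v (inj₂ ℓ) → ¬ 𝓕 a g
  plain-edge-avoids-leaf (e , f , _ , ve) l Fg with
    only-F-edge-at (proj₁ f) Fg (InternalEdge⇒IsInternal (proj₂ f) ve) ve (Links⇒Endpointˡ l)
  ... | refl = leaf-not-internal (InternalEdge⇒IsInternal (proj₂ f) (Links⇒Endpointʳ l))

module SubgraphH (P : Profile) {c : ℕ} (𝓕 : Fin c → Pred (DE P) 0ℓ)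
                 (𝓕-minimal : ∀ a → MinimalCut P (𝓕 a))
                 (𝓕-parallel : ∀ a b → Parallel P (𝓕 a) (𝓕 b))
                 (DX DY : Fin c → Pred (DV P) 0ℓ) (D-spec : DSpec P 𝓕 DX DY)
                 (dec : ∀ a → Decomp P (DX a) (DY a)) (a : Fin c) where
  open DisplayGraph P
  open CutSides P 𝓕 𝓕-minimal 𝓕-parallel DX DY D-spec
  open GPrime P DX DY dec
  open Decomp (dec a)

  x-in-X : ∀ p → DX a (x p)
  x-in-X p = proj₂ X≐ (inj₁ (p , refl))

  y-in-Y : ∀ p → DY a (y p)
  y-in-Y p = proj₂ Y≐ (inj₁ (p , refl))

  X-vertex : ∀ {v} → DX a v → (∃[ i ] x i ≡ v) ⊎ DY a v
  X-vertex u with proj₁ X≐ u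
  ... | inj₁ xi         = inj₁ xi
  ... | inj₂ (l , refl) = inj₂ (proj₂ Y≐ (inj₂ (l , refl)))

  Y-vertex : ∀ {v} → DY a v → (∃[ i ] y i ≡ v) ⊎ DX a v
  Y-vertex w with proj₁ Y≐ w
  ... | inj₁ yi         = inj₁ yi
  ... | inj₂ (l , refl) = inj₂ (proj₂ X≐ (inj₂ (l , refl)))

  rung : Fin m → E
  rung p = proj₁ (xy-edge p)

  rung-links : ∀ p → Links (dends P) (rung p) (x p) (y p)
  rung-links p = proj₁ (proj₂ (xy-edge p))

  rung-plain : ∀ p → F′ a (rung p) × ¬ Crosses a (rung p)
  rung-plain p = edge-with-origins (proj₂ (proj₂ (xy-edge p))) (rung-links p)
                                   (DX⇒Origin (x-in-X p)) (DY⇒Origin (y-in-Y p))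

  x-plain : ∀ p → Plain a (x p)
  x-plain p = rung p , proj₁ (rung-plain p) , proj₂ (rung-plain p) , Links⇒Endpointˡ (rung-links p)

  y-plain : ∀ p → Plain a (y p)
  y-plain p = rung p , proj₁ (rung-plain p) , proj₂ (rung-plain p) , Links⇒Endpointʳ (rung-links p)

  x-in-A : ∀ p → Sep a (anchor a) (x p)
  x-in-A p = plain-X-side (x-plain p) (x-in-X p)

  y-not-in-A : ∀ p → ¬ Sep a (anchor a) (y p)
  y-not-in-A p = plain-Y-side (y-plain p) (y-in-Y p)

  x-not-in-Y : ∀ p → ¬ DY a (x p)
  x-not-in-Y p = plain-not-in-X∩Y (x-plain p) (x-in-X p)

  y-not-in-X : ∀ p → ¬ DX a (y p)
  y-not-in-X p yX = plain-not-in-X∩Y (y-plain p) yX (y-in-Y p)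

  x≢y : ∀ p q → x p ≢ y q
  x≢y p q x≡y = x-not-in-Y p (subst (DY a) (sym x≡y) (y-in-Y q))

  H-internal : ∀ {v} → Fᵤ a v → IsInternal P v
  H-internal = Origin⇒IsInternal ∘ DX⊎DY⇒Origin

  x-internal : ∀ p → IsInternal P (x p)
  x-internal p = H-internal (inj₁ (x-in-X p))

  y-internal : ∀ p → IsInternal P (y p)
  y-internal p = H-internal (inj₂ (y-in-Y p))

  GAdj-rung : ∀ {g p q} → Links (dends P) g (x p) (y q) → p ≡ q
  GAdj-rung {g} {p} {q} l =
    y-inj p q (Endpoint-unique (Links⇒Endpointˡ (rung-links p)) (Links⇒Endpointʳ (rung-links p))
                               yq-on-rung (x≢y p p) (x≢y p q))
    where
    g-in-F′ : F′ a g
    g-in-F′ = internal-edge-in-F′ (IsInternal⇒InternalEdge l (x-internal p) (y-internal q)) l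
                                  (DX⇒Origin (x-in-X p)) (DY⇒Origin (y-in-Y q))
    g≡rung : g ≡ rung p
    g≡rung = only-F-edge-at (proj₁ (proj₁ (rung-plain p))) (proj₁ (proj₁ g-in-F′)) (x-internal p)
                            (Links⇒Endpointˡ (rung-links p)) (Links⇒Endpointˡ l)
    yq-on-rung : Endpoint (dends P) (y q) (rung p)
    yq-on-rung = subst (Endpoint (dends P) (y q)) g≡rung (Links⇒Endpointʳ l)

  O⇒Origin : ∀ {b j v} → Decomp.O (dec b) j v → Origin b v
  O⇒Origin {b} (inj₁ (i , _ , refl))        = DX⇒Origin (proj₂ (Decomp.X≐ (dec b)) (inj₁ (i , refl)))
  O⇒Origin {b} (inj₂ (inj₁ (i , _ , refl))) = DY⇒Origin (proj₂ (Decomp.Y≐ (dec b)) (inj₁ (i , refl)))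
  O⇒Origin {b} (inj₂ (inj₂ (l , refl)))     = DX⇒Origin (proj₂ (Decomp.X≐ (dec b)) (inj₂ (l , refl)))

  O-x : ∀ {j p} → O j (x p) → toℕ p ≤ toℕ j
  O-x {j} (inj₁ (i , i≤j , xi≡xp))   = subst (λ k → toℕ k ≤ toℕ j) (x-inj _ _ xi≡xp) i≤j
  O-x (inj₂ (inj₁ (i , _ , yi≡xp))) = ⊥-elim (x-not-in-Y _ (subst (DY a) yi≡xp (y-in-Y i)))
  O-x (inj₂ (inj₂ (l , zl≡xp)))     = ⊥-elim (xz _ l (sym zl≡xp))

  O-y : ∀ {j q} → O j (y q) → toℕ j ≤ toℕ q
  O-y (inj₁ (i , _ , xi≡yq))         = ⊥-elim (x≢y i _ xi≡yq)
  O-y {j} (inj₂ (inj₁ (i , j≤i , yi≡yq))) = subst (λ k → toℕ j ≤ toℕ k) (y-inj _ _ yi≡yq) j≤i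
  O-y (inj₂ (inj₂ (l , zl≡yq)))     = ⊥-elim (yz _ l (sym zl≡yq))

  -- x_p ~ y_q in G′ forces p ≤ q: the cliques of other cuts and the leaf cliques would join
  -- x_p ∈ A to y_q ∉ A in G − F_a.
  rung-order : ∀ p q → Adj′ (x p) (y q) → toℕ p ≤ toℕ q
  rung-order p q adj = decidable-stable (toℕ p ≤? toℕ q) (by-adjacency adj)
    where
    separated : ¬ Sep a (x p) (y q)
    separated s = y-not-in-A q (Conn-trans (x-in-A p) s)

    clique-origins : ∀ {b u w}
                   → Both (DX b) u w ⊎ Both (DY b) u w ⊎ ∃[ j ] Both (Decomp.O (dec b) j) u w
                   → Origin b u × Origin b w
    clique-origins (inj₁ (u , w))               = DX⇒Origin u , DX⇒Origin w
    clique-origins (inj₂ (inj₁ (u , w)))        = DY⇒Origin u , DY⇒Origin w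
    clique-origins (inj₂ (inj₂ (_ , u , w)))    = O⇒Origin u , O⇒Origin w

    own-clique : Both (DX a) (x p) (y q) ⊎ Both (DY a) (x p) (y q) ⊎ ∃[ j ] Both (O j) (x p) (y q)
               → toℕ p ≤ toℕ q
    own-clique (inj₁ (_ , yX))             = ⊥-elim (y-not-in-X q yX)
    own-clique (inj₂ (inj₁ (xY , _)))      = ⊥-elim (x-not-in-Y p xY)
    own-clique (inj₂ (inj₂ (_ , xO , yO))) = ≤-trans (O-x xO) (O-y yO)

    by-adjacency : Adj′ (x p) (y q) → DoubleNegation (toℕ p ≤ toℕ q)
    by-adjacency (_ , inj₁ (_ , l)) = pure (≤-reflexive (cong toℕ (GAdj-rung l)))
    by-adjacency (_ , inj₂ (inj₁ (b , cl))) with b ≟ a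
    ... | yes refl = pure (own-clique cl)
    ... | no b≢a   = λ _ → plain-ends-joined (b≢a ∘ sym) (x-plain p) (y-plain q)
                                  (proj₁ (clique-origins cl)) (proj₂ (clique-origins cl)) separated
    by-adjacency (_ , inj₂ (inj₂ (ℓ , (g , xℓ) , (h , yℓ)))) = contradiction
      (step h (plain-edge-avoids-leaf (y-plain q) yℓ)
        (Conn-edge (plain-edge-avoids-leaf (x-plain p) xℓ) xℓ) (Links-sym yℓ))
      separated

  Adj′-sym : ∀ {u w} → Adj′ u w → Adj′ w u
  Adj′-sym (u≢w , adj) =
    u≢w ∘ sym , ⊎.map (map₂ Links-sym) (⊎.map (map₂ (⊎.map swap (⊎.map swap (map₂ swap)))) (map₂ swap)) adj

  X-clique : ∀ {u w} → DX a u → DX a w → u ≢ w → Adj′ u w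
  X-clique u w u≢w = u≢w , inj₂ (inj₁ (a , inj₁ (u , w)))

  Y-clique : ∀ {u w} → DY a u → DY a w → u ≢ w → Adj′ u w
  Y-clique u w u≢w = u≢w , inj₂ (inj₁ (a , inj₂ (inj₁ (u , w))))

  O-clique : ∀ {i k} → toℕ i ≤ toℕ k → Adj′ (x i) (y k)
  O-clique {i} {k} i≤k =
    x≢y i k , inj₂ (inj₁ (a , inj₂ (inj₂ (i , xi∈Oi , yk∈Oi))))
    where
    xi∈Oi : O i (x i)
    xi∈Oi = inj₁ (i , ≤-refl , refl)
    yk∈Oi : O i (y k)
    yk∈Oi = inj₂ (inj₁ (k , i≤k , refl))

  -- If neither x_i y_k nor x_i′ y_k′ lies in a set of O_a, rung-order gives i ≤ k′ < i′ ≤ k < i.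
  no-crossing : ∀ {u u' w w'} → DX a u → DX a u' → DY a w → DY a w' → u ≢ w → u' ≢ w'
              → Adj′ u' w → Adj′ w' u → Adj′ u w ⊎ Adj′ u' w'
  no-crossing u u' w w' u≢w u'≢w' u'~w w'~u with X-vertex u | X-vertex u' | Y-vertex w | Y-vertex w'
  ... | inj₂ uY | _        | _       | _        = inj₁ (Y-clique uY w u≢w)
  ... | _      | inj₂ u'Y | _       | _        = inj₂ (Y-clique u'Y w' u'≢w')
  ... | _      | _        | inj₂ wX | _        = inj₁ (X-clique u wX u≢w)
  ... | _      | _        | _       | inj₂ w'X = inj₂ (X-clique u' w'X u'≢w')
  ... | inj₁ (i , refl) | inj₁ (i' , refl) | inj₁ (k , refl) | inj₁ (k' , refl)
    with toℕ i ≤? toℕ k | toℕ i' ≤? toℕ k'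
  ... | yes i≤k | _        = inj₁ (O-clique i≤k)
  ... | no _    | yes i'≤k' = inj₂ (O-clique i'≤k')
  ... | no i≰k  | no i'≰k'  = ⊥-elim (<-irrefl refl
        (<-≤-trans (≰⇒> i≰k) (≤-trans (rung-order i k' (Adj′-sym w'~u))
          (≤-trans (<⇒≤ (≰⇒> i'≰k')) (rung-order i' k u'~w)))))

  H-chordal : ChordalH a
  H-chordal = has-chord
    where open TwoCliqueCycles Adj′ (DX a) (DY a) X-clique Y-clique no-crossing

  x-of : ∀ {v} → Plain a v → DX a v → ∃[ i ] x i ≡ v
  x-of pv vX with X-vertex vX
  ... | inj₁ xi = xi
  ... | inj₂ vY = ⊥-elim (plain-not-in-X∩Y pv vX vY)

  y-of : ∀ {v} → Plain a v → DY a v → ∃[ i ] y i ≡ v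
  y-of pv vY with Y-vertex vY
  ... | inj₁ yi = yi
  ... | inj₂ vX = ⊥-elim (plain-not-in-X∩Y pv vX vY)

  internal-edge-is-rung : ∀ {g} → InternalEdge P g → Fᵤ a (end₁ g) → Fᵤ a (end₂ g)
                        → DoubleNegation (∃[ i ] Links (dends P) g (x i) (y i))
  internal-edge-is-rung {g} int s₁ s₂ =
    ¬¬-map by-side (ends-split (proj₁ uncrossed) (proj₂ uncrossed))
    where
    uncrossed : F′ a g × ¬ Crosses a g
    uncrossed = edge-with-origins int (inj₁ (refl , refl)) (DX⊎DY⇒Origin s₁) (DX⊎DY⇒Origin s₂)
    end-plain : ∀ {v} → Endpoint (dends P) v g → Plain a v
    end-plain vg = g , proj₁ uncrossed , proj₂ uncrossed , vg
    rung-between : ∀ {u w} → Links (dends P) g u w → DX a u → DY a w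
                 → ∃[ i ] Links (dends P) g (x i) (y i)
    rung-between l uX wY
      with x-of (end-plain (Links⇒Endpointˡ l)) uX | y-of (end-plain (Links⇒Endpointʳ l)) wY
    ... | i , refl | k , refl with GAdj-rung l
    ... | refl = i , l
    by-side : CrossesAt a g → ∃[ i ] Links (dends P) g (x i) (y i)
    by-side (inj₁ (X₁ , Y₂)) = rung-between (inj₁ (refl , refl)) X₁ Y₂
    by-side (inj₂ (Y₁ , X₂)) = rung-between (inj₂ (refl , refl)) X₂ Y₁

  -- Two rungs x_i y_i and x_j y_j in one clique give i ≤ j ≤ i.
  H-no-illegal : NoIllegalH a
  H-no-illegal K (K⊆H , _) (inj₁ (u , w , Ku , Kw , _ , leaf)) = [ not-leaf Ku , not-leaf Kw ]′ leaf
    where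
    not-leaf : ∀ {v} → K v → ¬ IsLeaf P v
    not-leaf Kv (_ , refl) = leaf-not-internal (H-internal (K⊆H Kv))
  H-no-illegal K (K⊆H , K-clique) (inj₂ (e , e' , e≢e' , (K₁ , K₂) , (K₁' , K₂') , int)) =
    internal-edge-is-rung int (K⊆H K₁) (K⊆H K₂) λ (i , l) →
    internal-edge-is-rung int' (K⊆H K₁') (K⊆H K₂') λ (j , l') →
    e≢e' (same-rung l l')
    where
    int' : InternalEdge P e'
    int' = IsInternal⇒InternalEdge (inj₁ (refl , refl)) (H-internal (K⊆H K₁')) (H-internal (K⊆H K₂'))
    ends-in-K : ∀ {g u w} → Links (dends P) g u w → K (end₁ g) → K (end₂ g) → K u × K w
    ends-in-K l k₁ k₂ = Endpoint-in (Links⇒Endpointˡ l) k₁ k₂ , Endpoint-in (Links⇒Endpointʳ l) k₁ k₂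
    same-rung : ∀ {i j} → Links (dends P) e (x i) (y i) → Links (dends P) e' (x j) (y j) → e ≡ e'
    same-rung {i} {j} l l' with ends-in-K l K₁ K₂ | ends-in-K l' K₁' K₂'
    ... | xi∈K , yi∈K | xj∈K , yj∈K
      with toℕ-injective (≤-antisym (rung-order i j (K-clique _ _ xi∈K yj∈K (x≢y i j)))
                                    (rung-order j i (K-clique _ _ xj∈K yi∈K (x≢y j i))))
    ... | refl =
      Links-unique e e' (IsInternal-tree (x-internal i) (Links⇒Endpointˡ l) (Links⇒Endpointˡ l')) l l'

lemma11 : (P : Profile) → Connected P
    → (c : ℕ) (𝓕 : Fin c → Pred (DE P) 0ℓ) → MinCompleteFamily P c 𝓕
    → (DX DY : Fin c → Pred (DV P) 0ℓ) → DSpec P 𝓕 DX DY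
    → (dec : ∀ a → Decomp P (DX a) (DY a))
    → (a : Fin c)
    → GPrime.ChordalH P DX DY dec a × GPrime.NoIllegalH P DX DY dec a
lemma11 P _ c 𝓕 (_ , minimal , _ , parallel , _) DX DY D-spec dec a = H-chordal , H-no-illegal
  where open SubgraphH P 𝓕 minimal parallel DX DY D-spec dec a
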